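{- Let $f\colon\mathbb{N}\to\mathbb{N}$ be an arbitrary computable function. No online algorithm with advice that reads at most $f(n)$ advice bits on instances of length $n$ solves the simple unbounded knapsack problem optimally (i.e., with $\mathrm{gain}(I)=\mathrm{opt}(I)$ on every instance $I$).
   Context: Online simple unbounded knapsack problem: knapsack capacity $1$; an instance is a sequence of items $x_1,\dots,x_n$ ($n$ unknown to the algorithm) with sizes $s_i\in[0,1]$ and values $v_i=s_i$. Items arrive one by one; upon arrival of $x_i$ the algorithm irrevocably chooses a number $k_i\in\mathbb{N}_0$ of copies to pack, with the total packed size never exceeding $1$. $\mathrm{gain}(I)$ is the total packed value and $\mathrm{opt}(I)=\max\{\sum_i k_i v_i: k_i\in\mathbb{N}_0,\sum_i k_i s_i\le1\}$. Advice model (tape model): an oracle knowing the whole instance writes an infinite binary advice string, which the deterministic online algorithm may read from the beginning; the algorithm uses $f(n)$ advice bits if on every instance with $n$ items it reads at most the first $f(n)$ bits. -}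

module Defs where

open import Data.Nat using (ℕ; _<_)
open import Data.Bool using (Bool)
open import Data.Integer using (+_)
open import Data.Rational using (ℚ; 0ℚ; 1ℚ; _/_; _≤_; _+_; _*_)
open import Data.List using (List; []; _∷_; _++_; [_]; length)
open import Data.Product using (Σ; _×_; proj₁)
open import Relation.Binary.PropositionalEquality using (_≡_)

Item : Set
Item = Σ ℚ (λ s → (0ℚ ≤ s) × (s ≤ 1ℚ))

size : Item → ℚ
size = proj₁

value : Item → ℚ
value = proj₁   -- simple knapsack: v_i = s_i

Instance : Set
Instance = List Item

Advice : Set
Advice = ℕ → Bool

-- Deterministic online algorithm with advice: given the advice tape,
-- the items seen so far and the current item, it chooses the number of
-- copies of the current item to pack.
OnlineAlg : Set
OnlineAlg = Advice → List Item → Item → ℕ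

runFrom : OnlineAlg → Advice → List Item → Instance → List ℕ
runFrom A φ past []       = []
runFrom A φ past (x ∷ xs) = A φ past x ∷ runFrom A φ (past ++ [ x ]) xs

run : OnlineAlg → Advice → Instance → List ℕ
run A φ I = runFrom A φ [] I

ℕtoℚ : ℕ → ℚ
ℕtoℚ k = + k / 1

packedSize : Instance → List ℕ → ℚ
packedSize (x ∷ xs) (k ∷ ks) = ℕtoℚ k * size x + packedSize xs ks
packedSize _        _        = 0ℚ

packedValue : Instance → List ℕ → ℚ
packedValue (x ∷ xs) (k ∷ ks) = ℕtoℚ k * value x + packedValue xs ks
packedValue _        _        = 0ℚ

Feasible : Instance → List ℕ → Set
Feasible I ks = (length ks ≡ length I) × (packedSize I ks ≤ 1ℚ)

-- opt(I) = max { Σ kᵢ vᵢ : Σ kᵢ sᵢ ≤ 1 };  "gain(I) = opt(I)" for a feasible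
-- packing ks means no feasible packing has larger value.
IsOptimal : Instance → List ℕ → Set
IsOptimal I ks = Feasible I ks × ((ks' : List ℕ) → Feasible I ks' → packedValue I ks' ≤ packedValue I ks)

AgreeUpTo : ℕ → Advice → Advice → Set
AgreeUpTo m φ ψ = (i : ℕ) → i < m → φ i ≡ ψ i

-- On instance I with advice φ, the algorithm uses at most f(n) advice bits
-- (n = length I): its behaviour is determined by the first f(n) bits.
ReadsAtMost : (ℕ → ℕ) → OnlineAlg → Advice → Instance → Set
ReadsAtMost f A φ I = (ψ : Advice) → AgreeUpTo (f (length I)) φ ψ → run A ψ I ≡ run A φ I

-- Write m = f 2 and fix an odd denominator D > 4·2^m. For every k ≤ 2^m the two-item
-- instance (2/D, (D − 2k)/D) can be filled exactly, and (k, 1) is its only exact packing: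
-- an odd total needs an odd number of copies of the odd item, and two copies overflow.
-- So an optimal algorithm must pack k copies of the first item, which is the same in all
-- these instances; that decision is a function of the first m advice bits, which take only
-- 2^m values, so by pigeonhole two of the 2^m + 1 instances force the same decision.
module Submission where

open import Defs
open import Data.Bool using (Bool)
open import Data.Empty using (⊥-elim)
open import Data.Fin using (Fin; zero; suc; toℕ; combine)
open import Data.Fin.Properties using (2↔Bool; combine-injective; pigeonhole; toℕ≤pred[n])
open import Data.Integer as ℤ using (+_)
import Data.Integer.Properties as ℤ
open import Data.List using ([]; _∷_; zipWith)
open import Data.List.Properties using (∷-injectiveˡ)
open import Data.List.Relation.Binary.Pointwise using (Pointwise; []; _∷_)
open import Data.Nat using (ℕ; zero; suc; _+_; _*_; _∸_; _^_; _≤_; z≤n; s≤s)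
open import Data.Nat.ListAction using (sum)
open import Data.Nat.Properties
open import Data.Product using (Σ; _×_; _,_; proj₁; proj₂; uncurry)
open import Data.Rational as ℚ using (ℚ; 0ℚ; 1ℚ; _/_; toℚᵘ)
import Data.Rational.Properties as ℚ
open import Data.Rational.Unnormalised using (mkℚᵘ; *≡*; *≤*) renaming (_≃_ to _≃ᵘ_)
import Data.Rational.Unnormalised.Properties as ℚᵘ
open import Function using (Inverse; Injection; _∘_)
open import Function.Properties.Inverse using (↔-sym; Inverse⇒Injection)
open import Relation.Binary.PropositionalEquality
open import Relation.Nullary using (¬_)

-- Writing the sizes of an instance over a common denominator moves the knapsack
-- arithmetic from ℚ to numerators in ℕ.
infix 4 _≐_/1+_

_≐_/1+_ : ℚ → ℕ → ℕ → Set
p ≐ a /1+ d = toℚᵘ p ≃ᵘ mkℚᵘ (+ a) d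

module _ {d : ℕ} where

  /-≐ : ∀ a → (+ a / suc d) ≐ a /1+ d
  /-≐ a = ℚ.toℚᵘ-fromℚᵘ (mkℚᵘ (+ a) d)

  0ℚ≐0 : 0ℚ ≐ 0 /1+ d
  0ℚ≐0 = *≡* refl

  1ℚ≐1+d : 1ℚ ≐ suc d /1+ d
  1ℚ≐1+d = *≡* (ℤ.*-comm (+ 1) (+ suc d))

  +-≐ : ∀ {p q a b} → p ≐ a /1+ d → q ≐ b /1+ d → p ℚ.+ q ≐ a + b /1+ d
  +-≐ {p} {q} {a} {b} p≐a q≐b =
    ℚᵘ.≃-trans (ℚ.toℚᵘ-homo-+ p q) (ℚᵘ.≃-trans (ℚᵘ.+-cong p≐a q≐b) (*≡* sameDenominator))
    where
    open ≡-Reasoning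
    D = + suc d
    sameDenominator : (+ a ℤ.* D ℤ.+ + b ℤ.* D) ℤ.* D ≡ + (a + b) ℤ.* + (suc d * suc d)
    sameDenominator = begin
      (+ a ℤ.* D ℤ.+ + b ℤ.* D) ℤ.* D  ≡⟨ cong (ℤ._* D) (ℤ.*-distribʳ-+ D (+ a) (+ b)) ⟨
      (+ a ℤ.+ + b) ℤ.* D ℤ.* D        ≡⟨ ℤ.*-assoc (+ a ℤ.+ + b) D D ⟩
      (+ a ℤ.+ + b) ℤ.* (D ℤ.* D)      ≡⟨ cong₂ ℤ._*_ (ℤ.pos-+ a b) (ℤ.pos-* (suc d) (suc d)) ⟨
      + (a + b) ℤ.* + (suc d * suc d)  ∎

  ℕtoℚ-*-≐ : ∀ k {p a} → p ≐ a /1+ d → ℕtoℚ k ℚ.* p ≐ k * a /1+ d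
  ℕtoℚ-*-≐ k {p} {a} p≐a =
    ℚᵘ.≃-trans (ℚ.toℚᵘ-homo-* (ℕtoℚ k) p)
      (ℚᵘ.≃-trans (ℚᵘ.*-cong (ℚ.toℚᵘ-fromℚᵘ (mkℚᵘ (+ k) 0)) p≐a) (*≡* scaledNumerator))
    where
    scaledNumerator : (+ k ℤ.* + a) ℤ.* + suc d ≡ + (k * a) ℤ.* + (1 * suc d)
    scaledNumerator = cong₂ (λ n m → n ℤ.* + m) (sym (ℤ.pos-* k a)) (sym (*-identityˡ (suc d)))

  ≐-mono-≤ : ∀ {p q a b} → p ≐ a /1+ d → q ≐ b /1+ d → a ≤ b → p ℚ.≤ q
  ≐-mono-≤ p≐a q≐b a≤b = ℚ.toℚᵘ-cancel-≤
    (ℚᵘ.≤-respˡ-≃ (ℚᵘ.≃-sym p≐a) (ℚᵘ.≤-respʳ-≃ (ℚᵘ.≃-sym q≐b)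
      (*≤* (ℤ.*-monoʳ-≤-nonNeg (+ suc d) (ℤ.+≤+ a≤b)))))

  ≐-unique : ∀ {p q a} → p ≐ a /1+ d → q ≐ a /1+ d → p ≡ q
  ≐-unique p≐a q≐a = ℚ.toℚᵘ-injective (ℚᵘ.≃-trans p≐a (ℚᵘ.≃-sym q≐a))

  ≐-injective : ∀ {p a b} → p ≐ a /1+ d → p ≐ b /1+ d → a ≡ b
  ≐-injective {a = a} {b} p≐a p≐b with *≡* eq ← ℚᵘ.≃-trans (ℚᵘ.≃-sym p≐a) p≐b =
    ℤ.+-injective (ℤ.*-cancelʳ-≡ (+ a) (+ b) (+ suc d) eq)

fraction : (a d : ℕ) → a ≤ suc d → Item
fraction a d a≤1+d = + a / suc d , ≐-mono-≤ 0ℚ≐0 (/-≐ a) z≤n , ≐-mono-≤ (/-≐ a) 1ℚ≐1+d a≤1+d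

packedSize-≐ : ∀ {d I as} → Pointwise (λ x a → size x ≐ a /1+ d) I as →
               ∀ ks → packedSize I ks ≐ sum (zipWith _*_ ks as) /1+ d
packedSize-≐ []            []       = 0ℚ≐0
packedSize-≐ []            (_ ∷ _)  = 0ℚ≐0
packedSize-≐ (_ ∷ _)       []       = 0ℚ≐0
packedSize-≐ (x≐a ∷ I≐as) (k ∷ ks) = +-≐ (ℕtoℚ-*-≐ k x≐a) (packedSize-≐ I≐as ks)

packedValue≡packedSize : ∀ I ks → packedValue I ks ≡ packedSize I ks
packedValue≡packedSize []      _        = refl
packedValue≡packedSize (_ ∷ _) []       = refl
packedValue≡packedSize (x ∷ I) (k ∷ ks) = cong (ℚ._+_ (ℕtoℚ k ℚ.* size x)) (packedValue≡packedSize I ks)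

optimal-fills : ∀ {I ks} ks′ → Feasible I ks′ → packedSize I ks′ ≡ 1ℚ →
                IsOptimal I ks → packedSize I ks ≡ 1ℚ
optimal-fills {I} {ks} ks′ feasible′ fills′ ((_ , fits) , optimal) = ℚ.≤-antisym fits (begin
  1ℚ                ≡⟨ fills′ ⟨
  packedSize I ks′  ≡⟨ packedValue≡packedSize I ks′ ⟨
  packedValue I ks′ ≤⟨ optimal ks′ feasible′ ⟩
  packedValue I ks  ≡⟨ packedValue≡packedSize I ks ⟩
  packedSize I ks   ∎)
  where open ℚ.≤-Reasoning

1+[m+n]*2≡m*2+[1+n*2] : ∀ m n → suc ((m + n) * 2) ≡ m * 2 + suc (n * 2)
1+[m+n]*2≡m*2+[1+n*2] m n = trans (cong suc (*-distribʳ-+ 2 m n)) (sym (+-suc (m * 2) (n * 2)))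

odd-fill-unique : ∀ {j l k c} → k ≤ c → j * 2 + l * suc (c * 2) ≡ suc ((k + c) * 2) → j ≡ k × l ≡ 1
odd-fill-unique {j} {zero} {k} {c} _ fill = ⊥-elim (even≢odd j (k + c) (begin
  2 * j                ≡⟨ *-comm 2 j ⟩
  j * 2                ≡⟨ +-identityʳ (j * 2) ⟨
  j * 2 + 0            ≡⟨ fill ⟩
  suc ((k + c) * 2)    ≡⟨ cong suc (*-comm (k + c) 2) ⟩
  suc (2 * (k + c))    ∎))
  where open ≡-Reasoning
odd-fill-unique {j} {suc zero} {k} {c} _ fill =
  *-cancelʳ-≡ j k 2 (+-cancelʳ-≡ (suc (c * 2)) (j * 2) (k * 2) (begin
    j * 2 + suc (c * 2)        ≡⟨ cong (_+_ (j * 2)) (+-identityʳ (suc (c * 2))) ⟨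
    j * 2 + 1 * suc (c * 2)    ≡⟨ fill ⟩
    suc ((k + c) * 2)          ≡⟨ 1+[m+n]*2≡m*2+[1+n*2] k c ⟩
    k * 2 + suc (c * 2)        ∎)) , refl
  where open ≡-Reasoning
odd-fill-unique {j} {suc (suc l)} {k} {c} k≤c fill = ⊥-elim (<-irrefl (sym fill) (begin-strict
  suc ((k + c) * 2)                  ≡⟨ 1+[m+n]*2≡m*2+[1+n*2] k c ⟩
  k * 2 + suc (c * 2)                <⟨ +-monoˡ-< (suc (c * 2)) (s≤s (*-monoˡ-≤ 2 k≤c)) ⟩
  suc (c * 2) + suc (c * 2)          ≤⟨ +-monoʳ-≤ (suc (c * 2)) (m≤m+n (suc (c * 2)) (l * suc (c * 2))) ⟩
  suc (suc l) * suc (c * 2)          ≤⟨ m≤n+m _ (j * 2) ⟩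
  j * 2 + suc (suc l) * suc (c * 2)  ∎))
  where open ≤-Reasoning

module HardInstances (n : ℕ) where

  d : ℕ
  d = suc n * 2

  x₁ : Item
  x₁ = fraction 2 d (s≤s (s≤s z≤n))

  x₂ : ℕ → Item
  x₂ k = fraction (suc ((suc n ∸ k) * 2)) d (s≤s (*-monoˡ-≤ 2 (m∸n≤m (suc n) k)))

  hard : ℕ → Instance
  hard k = x₁ ∷ x₂ k ∷ []

  hard-optimal : ∀ {k} → k + k ≤ suc n → ∀ ks → IsOptimal (hard k) ks → ks ≡ k ∷ 1 ∷ []
  hard-optimal         _       []                ((() , _) , _)
  hard-optimal         _       (_ ∷ [])          ((() , _) , _)
  hard-optimal         _       (_ ∷ _ ∷ _ ∷ _)   ((() , _) , _)
  hard-optimal {k} 2k≤1+n (j ∷ l ∷ []) optimal =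
    uncurry (cong₂ λ j l → j ∷ l ∷ []) (odd-fill-unique k≤c fill)
    where
    c = suc n ∸ k
    e = suc (c * 2)

    k≤c : k ≤ c
    k≤c = m+n≤o⇒m≤o∸n k 2k≤1+n

    capacity≐ : 1ℚ ≐ suc ((k + c) * 2) /1+ d
    capacity≐ = subst (λ s → 1ℚ ≐ suc (s * 2) /1+ d) (sym (m+[n∸m]≡n (m+n≤o⇒m≤o k 2k≤1+n))) 1ℚ≐1+d

    size≐ : ∀ j l → packedSize (hard k) (j ∷ l ∷ []) ≐ j * 2 + l * e /1+ d
    size≐ j l = subst (packedSize (hard k) (j ∷ l ∷ []) ≐_/1+ d)
                      (cong (_+_ (j * 2)) (+-identityʳ (l * e)))
                      (packedSize-≐ {I = hard k} (/-≐ 2 ∷ /-≐ e ∷ []) (j ∷ l ∷ []))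

    exact : packedSize (hard k) (k ∷ 1 ∷ []) ≡ 1ℚ
    exact = ≐-unique (subst (packedSize (hard k) (k ∷ 1 ∷ []) ≐_/1+ d) k*2+1*e≡1+[k+c]*2 (size≐ k 1))
                     capacity≐
      where
      k*2+1*e≡1+[k+c]*2 : k * 2 + 1 * e ≡ suc ((k + c) * 2)
      k*2+1*e≡1+[k+c]*2 = trans (cong (_+_ (k * 2)) (+-identityʳ e)) (sym (1+[m+n]*2≡m*2+[1+n*2] k c))

    fills : packedSize (hard k) (j ∷ l ∷ []) ≡ 1ℚ
    fills = optimal-fills {hard k} {j ∷ l ∷ []} (k ∷ 1 ∷ []) (refl , ℚ.≤-reflexive exact) exact optimal

    fill : j * 2 + l * e ≡ suc ((k + c) * 2)
    fill = ≐-injective (size≐ j l) (subst (_≐ suc ((k + c) * 2) /1+ d) (sym fills) capacity≐)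

bit : Bool → Fin 2
bit = Inverse.to (↔-sym 2↔Bool)

bit-injective : ∀ {b b′} → bit b ≡ bit b′ → b ≡ b′
bit-injective = Injection.injective (Inverse⇒Injection (↔-sym 2↔Bool))

prefixCode : (m : ℕ) → Advice → Fin (2 ^ m)
prefixCode zero    φ = zero
prefixCode (suc m) φ = combine (bit (φ 0)) (prefixCode m (φ ∘ suc))

prefixCode-agree : ∀ m {φ ψ} → prefixCode m φ ≡ prefixCode m ψ → AgreeUpTo m φ ψ
prefixCode-agree (suc m) {φ} {ψ} same = agree
  where
  split = combine-injective (bit (φ 0)) (prefixCode m (φ ∘ suc))
                            (bit (ψ 0)) (prefixCode m (ψ ∘ suc)) same
  agree : AgreeUpTo (suc m) φ ψ
  agree zero    _         = bit-injective (proj₁ split)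
  agree (suc i) (s≤s i<m) = prefixCode-agree m (proj₂ split) i i<m

theorem7 : (f : ℕ → ℕ) →
    ¬ (Σ OnlineAlg λ A → (I : Instance) →
         Σ Advice λ φ → ReadsAtMost f A φ I × IsOptimal I (run A φ I))
theorem7 f (A , solves) =
  let i , j , i<j , sameCode = pigeonhole (n<1+n (2 ^ m)) (prefixCode m ∘ advice)
      sameDecision = ∷-injectiveˡ (reads i (advice j) (prefixCode-agree m sameCode))
  in <-irrefl (trans (sym (decides i)) (trans (sym sameDecision) (decides j))) i<j
  where
  m : ℕ
  m = f 2
  open HardInstances (2 ^ m + 2 ^ m)

  advice : Fin (suc (2 ^ m)) → Advice
  advice i = proj₁ (solves (hard (toℕ i)))

  reads : ∀ i → ReadsAtMost f A (advice i) (hard (toℕ i))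
  reads i = proj₁ (proj₂ (solves (hard (toℕ i))))

  decides : ∀ i → A (advice i) [] x₁ ≡ toℕ i
  decides i = ∷-injectiveˡ (hard-optimal (m≤n⇒m≤1+n (+-mono-≤ (toℕ≤pred[n] i) (toℕ≤pred[n] i)))
                                          (run A (advice i) (hard (toℕ i)))
                                          (proj₂ (proj₂ (solves (hard (toℕ i))))))
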